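{- Define integers $P(n,k)$ for integers $0\le k\le n$ by $P(n,0)=2^n-1$, $P(n,n)=2^{n-2}n(n-1)+2^n-1$ for $n\ge1$ (and $P(0,0)=0$), and for $0<k<n$: $P(n,k)=P(n-1,k)+P(n-1,k-1)+k2^{k-1}+2^{n-1}$. Then for all integers $0\le k\le n$ and all $0\le m\le\min(k,n-k)$, $$P(n,k)=\sum_{i=0}^{m-1}\sum_{j=0}^{i}\binom{i}{j}\left((k-j)2^{k-j-1}+2^{n-i-1}\right)+\sum_{i=0}^{m}\binom{m}{i}P(n-m,k-i).$$ -}

module Defs where

open import Data.Nat using (ℕ; zero; suc; _+_; _*_; _∸_; _^_; _<ᵇ_; _≡ᵇ_)
open import Data.Bool using (if_then_else_)
open import Data.List using (map; upTo)
open import Data.Nat.ListAction using (sum)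
open import Data.Nat.Combinatorics using (_C_)

-- P n k, meaningful for k ≤ n; value 0 (arbitrary) when k > n.
P : ℕ → ℕ → ℕ
P zero    k       = 0
P (suc n) zero    = 2 ^ suc n ∸ 1
P (suc n) (suc k) =
  if k ≡ᵇ n then 2 ^ (n ∸ 1) * suc n * n + (2 ^ suc n ∸ 1)
  else if k <ᵇ n then P n (suc k) + P n k + suc k * 2 ^ k + 2 ^ n
  else 0

Σ< : ℕ → (ℕ → ℕ) → ℕ
Σ< m f = sum (map f (upTo m))

RHS : ℕ → ℕ → ℕ → ℕ
RHS n k m =
  Σ< m (λ i → Σ< (suc i) (λ j → (i C j) * ((k ∸ j) * 2 ^ (k ∸ j ∸ 1) + 2 ^ (n ∸ i ∸ 1))))
  + Σ< (suc m) (λ i → (m C i) * P (n ∸ m) (k ∸ i))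

-- The recurrence P(n,k) = P(n-1,k) + P(n-1,k-1) + g(n,k) is Pascal's rule with an
-- inhomogeneous term. Unfolding it once at every point of the m-th row of the
-- binomial expansion produces the (m+1)-th row, by Pascal's rule for binomial
-- coefficients, plus the binomial transform of g along the m-th row. The
-- hypotheses m ≤ k and m ≤ n - k keep every point where the recurrence is used
-- strictly inside the triangle 0 < k' < n'.
module Submission where

open import Defs
open import Data.Nat using (ℕ; _≤_; _∸_)
open import Relation.Binary.PropositionalEquality using (_≡_)

open import Data.Nat using (zero; suc; _+_; _*_; _^_; _<_; _≡ᵇ_; s<s)
open import Data.Nat.Properties
open import Data.Nat.ListAction using (sum)
open import Data.Nat.ListAction.Properties using (sum-++)
open import Data.Nat.Combinatorics using (_C_; k>n⇒nCk≡0; nCk+nC[k+1]≡[n+1]C[k+1])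
open import Data.Bool using (true)
open import Data.Bool.Properties using (T-≡; ¬-not)
open import Data.List using (map; upTo; applyUpTo; [_]; _++_)
open import Data.List.Properties using (map-upTo; upTo-∷ʳ; map-++)
open import Algebra.Properties.CommutativeSemigroup +-commutativeSemigroup using (interchange; x∙yz≈xz∙y)
open import Function using (_∘_; Equivalence)
open import Relation.Binary.PropositionalEquality using (refl; sym; trans; cong; cong₂; module ≡-Reasoning)
open ≡-Reasoning

Σ<-suc : ∀ m f → Σ< (suc m) f ≡ f 0 + Σ< m (f ∘ suc)
Σ<-suc m f = begin
  sum (map f (upTo (suc m)))           ≡⟨ cong sum (map-upTo f (suc m)) ⟩
  f 0 + sum (applyUpTo (f ∘ suc) m)    ≡⟨ cong (λ xs → f 0 + sum xs) (map-upTo (f ∘ suc) m) ⟨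
  f 0 + Σ< m (f ∘ suc)                 ∎

Σ<-snoc : ∀ m f → Σ< (suc m) f ≡ Σ< m f + f m
Σ<-snoc m f = begin
  sum (map f (upTo (suc m)))           ≡⟨ cong (sum ∘ map f) (upTo-∷ʳ m) ⟨
  sum (map f (upTo m ++ [ m ]))        ≡⟨ cong sum (map-++ f (upTo m) [ m ]) ⟩
  sum (map f (upTo m) ++ [ f m ])      ≡⟨ sum-++ (map f (upTo m)) [ f m ] ⟩
  Σ< m f + (f m + 0)                   ≡⟨ cong (Σ< m f +_) (+-identityʳ (f m)) ⟩
  Σ< m f + f m                         ∎

Σ<-cong : ∀ m {f g} → (∀ {i} → i < m → f i ≡ g i) → Σ< m f ≡ Σ< m g
Σ<-cong zero    _   = refl
Σ<-cong (suc m) {f} {g} f≗g = begin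
  Σ< (suc m) f   ≡⟨ Σ<-snoc m f ⟩
  Σ< m f + f m   ≡⟨ cong₂ _+_ (Σ<-cong m (λ i<m → f≗g (m<n⇒m<1+n i<m))) (f≗g (n<1+n m)) ⟩
  Σ< m g + g m   ≡⟨ Σ<-snoc m g ⟨
  Σ< (suc m) g   ∎

Σ<-+ : ∀ m f g → Σ< m (λ i → f i + g i) ≡ Σ< m f + Σ< m g
Σ<-+ zero    f g = refl
Σ<-+ (suc m) f g = begin
  Σ< (suc m) (λ i → f i + g i)           ≡⟨ Σ<-snoc m _ ⟩
  Σ< m (λ i → f i + g i) + (f m + g m)   ≡⟨ cong (_+ (f m + g m)) (Σ<-+ m f g) ⟩
  Σ< m f + Σ< m g + (f m + g m)          ≡⟨ interchange (Σ< m f) (Σ< m g) (f m) (g m) ⟩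
  (Σ< m f + f m) + (Σ< m g + g m)        ≡⟨ cong₂ _+_ (Σ<-snoc m f) (Σ<-snoc m g) ⟨
  Σ< (suc m) f + Σ< (suc m) g            ∎

binomialTransform : ℕ → (ℕ → ℕ) → ℕ
binomialTransform m f = Σ< (suc m) (λ i → (m C i) * f i)

binomialTransform-cong : ∀ m {f g} → (∀ {i} → i ≤ m → f i ≡ g i) →
                         binomialTransform m f ≡ binomialTransform m g
binomialTransform-cong m f≗g = Σ<-cong (suc m) (λ {i} i<1+m → cong ((m C i) *_) (f≗g (≤-pred i<1+m)))

binomialTransform-+ : ∀ m f g → binomialTransform m (λ i → f i + g i) ≡
                               binomialTransform m f + binomialTransform m g
binomialTransform-+ m f g = trans
  (Σ<-cong (suc m) (λ {i} _ → *-distribˡ-+ (m C i) (f i) (g i)))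
  (Σ<-+ (suc m) (λ i → (m C i) * f i) (λ i → (m C i) * g i))

binomialTransform-pascal : ∀ m f → binomialTransform (suc m) f ≡
                                   binomialTransform m f + binomialTransform m (f ∘ suc)
binomialTransform-pascal m f = begin
  binomialTransform (suc m) f                          ≡⟨ Σ<-suc (suc m) (λ i → (suc m C i) * f i) ⟩
  1 * f 0 + Σ< (suc m) (λ i → (suc m C suc i) * f (suc i))
    ≡⟨ cong (1 * f 0 +_) (Σ<-cong (suc m) (λ {i} _ → pascal i)) ⟩
  1 * f 0 + Σ< (suc m) (λ i → (m C i) * f (suc i) + (m C suc i) * f (suc i))
    ≡⟨ cong (1 * f 0 +_) (Σ<-+ (suc m) (λ i → (m C i) * f (suc i)) (λ i → (m C suc i) * f (suc i))) ⟩
  1 * f 0 + (binomialTransform m (f ∘ suc) + shifted)  ≡⟨ x∙yz≈xz∙y (1 * f 0) _ shifted ⟩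
  (1 * f 0 + shifted) + binomialTransform m (f ∘ suc)  ≡⟨ cong (_+ binomialTransform m (f ∘ suc)) padded ⟨
  binomialTransform m f + binomialTransform m (f ∘ suc) ∎
  where
  shifted : ℕ
  shifted = Σ< (suc m) (λ i → (m C suc i) * f (suc i))

  pascal : ∀ i → (suc m C suc i) * f (suc i) ≡ (m C i) * f (suc i) + (m C suc i) * f (suc i)
  pascal i = trans (cong (_* f (suc i)) (sym (nCk+nC[k+1]≡[n+1]C[k+1] m i)))
                   (*-distribʳ-+ (f (suc i)) (m C i) (m C suc i))

  padded : binomialTransform m f ≡ 1 * f 0 + shifted
  padded = begin
    binomialTransform m f                                ≡⟨ +-identityʳ (binomialTransform m f) ⟨
    binomialTransform m f + 0 * f (suc m)
      ≡⟨ cong (λ c → binomialTransform m f + c * f (suc m)) (k>n⇒nCk≡0 (n<1+n m)) ⟨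
    binomialTransform m f + (m C suc m) * f (suc m)      ≡⟨ Σ<-snoc (suc m) (λ i → (m C i) * f i) ⟨
    Σ< (suc (suc m)) (λ i → (m C i) * f i)              ≡⟨ Σ<-suc (suc m) (λ i → (m C i) * f i) ⟩
    1 * f 0 + shifted                                    ∎

m<n∸k⇒k<n∸m : ∀ {m n k} → k ≤ n → m < n ∸ k → k < n ∸ m
m<n∸k⇒k<n∸m {m} {n} {k} k≤n m<n∸k = m+n≤o⇒m≤o∸n (suc k)
  (≤-trans (≤-reflexive (cong suc (+-comm k m))) (m≤o∸n⇒m+n≤o (suc m) k≤n m<n∸k))

module InhomogeneousPascal
  (f g : ℕ → ℕ → ℕ)
  (recurrence : ∀ {a b} → 0 < b → b < a → f a b ≡ f (a ∸ 1) b + f (a ∸ 1) (b ∸ 1) + g a b)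
  where

  row : ℕ → ℕ → ℕ → ℕ
  row n k m = binomialTransform m (λ i → f (n ∸ m) (k ∸ i))

  source : ℕ → ℕ → ℕ → ℕ
  source n k i = binomialTransform i (λ j → g (n ∸ i) (k ∸ j))

  row-suc : ∀ {n k m} → k ≤ n → m < k → m < n ∸ k →
            row n k m ≡ row n k (suc m) + source n k m
  row-suc {n} {k} {m} k≤n m<k m<n∸k = begin
    row n k m                                              ≡⟨ binomialTransform-cong m recurrence-at ⟩
    binomialTransform m (λ i → (next i + next (suc i)) + g (n ∸ m) (k ∸ i))
      ≡⟨ binomialTransform-+ m (λ i → next i + next (suc i)) (λ i → g (n ∸ m) (k ∸ i)) ⟩
    binomialTransform m (λ i → next i + next (suc i)) + source n k m
      ≡⟨ cong (_+ source n k m) (binomialTransform-+ m next (next ∘ suc)) ⟩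
    binomialTransform m next + binomialTransform m (next ∘ suc) + source n k m
      ≡⟨ cong (_+ source n k m) (binomialTransform-pascal m next) ⟨
    row n k (suc m) + source n k m                         ∎
    where
    next : ℕ → ℕ
    next i = f (n ∸ suc m) (k ∸ i)

    recurrence-at : ∀ {i} → i ≤ m → f (n ∸ m) (k ∸ i) ≡ (next i + next (suc i)) + g (n ∸ m) (k ∸ i)
    recurrence-at {i} i≤m = begin
      f (n ∸ m) (k ∸ i)
        ≡⟨ recurrence (m<n⇒0<n∸m (≤-<-trans i≤m m<k)) (≤-<-trans (m∸n≤m k i) (m<n∸k⇒k<n∸m k≤n m<n∸k)) ⟩
      f (n ∸ m ∸ 1) (k ∸ i) + f (n ∸ m ∸ 1) (k ∸ i ∸ 1) + g (n ∸ m) (k ∸ i)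
        ≡⟨ cong₂ (λ a b → f a (k ∸ i) + f a b + g (n ∸ m) (k ∸ i)) (pred[m∸n]≡m∸[1+n] n m) (pred[m∸n]≡m∸[1+n] k i) ⟩
      (next i + next (suc i)) + g (n ∸ m) (k ∸ i) ∎

  unfold : ∀ n k m → k ≤ n → m ≤ k → m ≤ n ∸ k → f n k ≡ Σ< m (source n k) + row n k m
  unfold n k zero    _   _    _      = sym (trans (+-identityʳ _) (+-identityʳ _))
  unfold n k (suc m) k≤n m<k m<n∸k = begin
    f n k                                                    ≡⟨ unfold n k m k≤n (<⇒≤ m<k) (<⇒≤ m<n∸k) ⟩
    Σ< m (source n k) + row n k m                            ≡⟨ cong (Σ< m (source n k) +_) (row-suc k≤n m<k m<n∸k) ⟩
    Σ< m (source n k) + (row n k (suc m) + source n k m)     ≡⟨ x∙yz≈xz∙y (Σ< m (source n k)) (row n k (suc m)) (source n k m) ⟩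
    Σ< m (source n k) + source n k m + row n k (suc m)       ≡⟨ cong (_+ row n k (suc m)) (Σ<-snoc m (source n k)) ⟨
    Σ< (suc m) (source n k) + row n k (suc m)                ∎

inhomogeneity : ℕ → ℕ → ℕ
inhomogeneity n k = k * 2 ^ (k ∸ 1) + 2 ^ (n ∸ 1)

P-recurrence : ∀ {n k} → 0 < k → k < n → P n k ≡ P (n ∸ 1) k + P (n ∸ 1) (k ∸ 1) + inhomogeneity n k
P-recurrence {suc n} {suc k} _ (s<s k<n)
  rewrite ¬-not {k ≡ᵇ n} {true} (<⇒≢ k<n ∘ ≡ᵇ⇒≡ k n ∘ Equivalence.from T-≡)
        | Equivalence.to T-≡ (<⇒<ᵇ k<n)
  = +-assoc (P n (suc k) + P n k) (suc k * 2 ^ k) (2 ^ n)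

mainTheorem12 : (n k m : ℕ) → k ≤ n → m ≤ k → m ≤ n ∸ k → P n k ≡ RHS n k m
mainTheorem12 = InhomogeneousPascal.unfold P inhomogeneity P-recurrence
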